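{- Let $m,n\geq 2$ and $r\geq 1$ be integers. If $\frac{\eta(C_m^r)-1}{m-1}=\frac{\eta(C_n^r)-1}{n-1}=c$ for some $c\in\mathbb N$ and $\eta(C_{mn}^r)\geq c(mn-1)+1$, then $\eta(C_{mn}^r)=c(mn-1)+1$.
   Context: $C_n^r$ is the direct sum of $r$ copies of the cyclic group $C_n$. A sequence over $G$ is a finite unordered list of elements with repetition allowed; length counts multiplicity. $\eta(G)$ is the smallest integer $d$ such that every sequence over $G$ of length at least $d$ contains a subsequence with sum $0$ and length in $[1,\exp(G)]$. -}

module Defs where

open import Data.Nat using (ℕ; _≤_)
open import Data.Nat.Divisibility using (_∣_)
open import Data.Fin using (Fin; toℕ)
open import Data.Vec using (Vec; lookup)
open import Data.List using (List; length; map)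
open import Data.Nat.ListAction using (sum)
open import Data.List.Relation.Binary.Sublist.Propositional using (_⊆_)
open import Data.Product using (Σ; _×_)

-- Elements of C_n^r : r-tuples of residues mod n.
Elt : ℕ → ℕ → Set
Elt n r = Vec (Fin n) r

-- Sequences over C_n^r (unordered lists, represented as lists).
Seq : ℕ → ℕ → Set
Seq n r = List (Elt n r)

ZeroSum : ∀ {n r} → Seq n r → Set
ZeroSum {n} {r} T = (i : Fin r) → n ∣ sum (map (λ g → toℕ (lookup g i)) T)

-- Every sequence of length ≥ d over C_n^r has a zero-sum subsequence
-- of length in [1, exp(C_n^r)] = [1, n]   (exp(C_n^r) = n for r ≥ 1).
EtaProp : ℕ → ℕ → ℕ → Set
EtaProp n r d = (S : Seq n r) → d ≤ length S →
  Σ (Seq n r) (λ T → T ⊆ S × ZeroSum T × 1 ≤ length T × length T ≤ n)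

IsEta : ℕ → ℕ → ℕ → Set
IsEta n r d = EtaProp n r d × ((d' : ℕ) → EtaProp n r d' → d ≤ d')

{-# OPTIONS --safe #-}

-- Reducing coordinates mod n, every η(C_n^r) terms of a sequence over C_{mn}^r
-- contain a block of at most n terms whose sum lies in n·C_{mn}^r ≅ C_m^r.
-- Extracting blocks greedily from a sequence of length (η(C_m^r) − 1)n + η(C_n^r)
-- yields η(C_m^r) disjoint blocks; their sums divided by n form a sequence over
-- C_m^r, which has a zero-sum subsequence of at most m terms. The union of the
-- corresponding blocks is a zero-sum subsequence of at most mn terms, so
-- η(C_{mn}^r) ≤ (η(C_m^r) − 1)n + η(C_n^r) = c(mn − 1) + 1.

module Submission where

open import Defs
open import Data.Nat using (ℕ; zero; suc; _≤_; _*_; _+_; _∸_; z≤n; s≤s; NonZero; _%_; _/_)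
open import Data.Nat.Properties
open import Data.Nat.DivMod using (_mod_; %-distribˡ-+; m%n%n≡m%n; m/n*n≡m)
open import Data.Nat.Divisibility using (_∣_; m%n≡0⇒n∣m; n∣m⇒m%n≡0; *-pres-∣; ∣-refl)
open import Data.Nat.ListAction using (sum)
open import Data.Nat.ListAction.Properties using (sum-++; sum-↭)
open import Data.Nat.Tactic.RingSolver using (solve-∀)
open import Data.Fin using (Fin; toℕ)
open import Data.Fin.Properties using (toℕ-fromℕ<)
open import Data.Vec using (lookup; tabulate)
open import Data.Vec.Properties using (lookup∘tabulate)
open import Data.List using (List; []; _∷_; _++_; length; map; concat)
open import Data.List.Properties using (length-map; length-++; map-cong; map-∘; map-++)
open import Data.List.Relation.Unary.All as All using (All; []; _∷_)
open import Data.List.Relation.Binary.Sublist.Propositional using (_⊆_; []; _∷_; _∷ʳ_; ⊆-trans)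
open import Data.List.Relation.Binary.Sublist.Propositional.Properties using (All-resp-⊆)
open import Data.List.Relation.Binary.Sublist.Heterogeneous using (minimum)
open import Data.List.Relation.Binary.Permutation.Propositional using (_↭_; ↭-refl; ↭-trans)
open import Data.List.Relation.Binary.Permutation.Propositional.Properties using (↭-length; ++⁺ˡ; map⁺)
open import Data.List.Relation.Ternary.Interleaving.Properties using (interleave-length)
open import Data.List.Relation.Ternary.Interleaving.Propositional using (Interleaving; []; consˡ; consʳ; toPermutation)
open import Data.Product using (∃-syntax; _×_; _,_; proj₁; proj₂)
open import Relation.Binary.PropositionalEquality

private
  variable
    A B : Set
    T R S X T′ : List A
    Ts Ts′ : List (List A)

⊆⇒Interleaving : T ⊆ S → ∃[ R ] Interleaving T R S
⊆⇒Interleaving [] = [] , []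
⊆⇒Interleaving (y ∷ʳ τ) = let R , sp = ⊆⇒Interleaving τ in y ∷ R , consʳ sp
⊆⇒Interleaving (refl ∷ τ) = let R , sp = ⊆⇒Interleaving τ in R , consˡ sp

Interleaving⇒⊆ʳ : Interleaving T R S → R ⊆ S
Interleaving⇒⊆ʳ [] = []
Interleaving⇒⊆ʳ (consˡ sp) = _ ∷ʳ Interleaving⇒⊆ʳ sp
Interleaving⇒⊆ʳ (consʳ sp) = refl ∷ Interleaving⇒⊆ʳ sp

Interleaving-⊆ʳ : Interleaving T R S → X ⊆ R → ∃[ Y ] Y ⊆ S × Interleaving T X Y
Interleaving-⊆ʳ [] [] = [] , [] , []
Interleaving-⊆ʳ (consˡ sp) σ =
  let Y , υ , sp′ = Interleaving-⊆ʳ sp σ in _ ∷ Y , refl ∷ υ , consˡ sp′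
Interleaving-⊆ʳ (consʳ sp) (x ∷ʳ σ) =
  let Y , υ , sp′ = Interleaving-⊆ʳ sp σ in Y , x ∷ʳ υ , sp′
Interleaving-⊆ʳ (consʳ sp) (refl ∷ σ) =
  let Y , υ , sp′ = Interleaving-⊆ʳ sp σ in _ ∷ Y , refl ∷ υ , consʳ sp′

⊆-map⁻ : (f : A → B) (S : List A) → T′ ⊆ map f S → ∃[ T ] T ⊆ S × map f T ≡ T′
⊆-map⁻ f [] [] = [] , [] , refl
⊆-map⁻ f (x ∷ S) (_ ∷ʳ τ) = let T , σ , eq = ⊆-map⁻ f S τ in T , x ∷ʳ σ , eq
⊆-map⁻ f (x ∷ S) (refl ∷ τ) =
  let T , σ , eq = ⊆-map⁻ f S τ in x ∷ T , refl ∷ σ , cong (f x ∷_) eq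

data DisjointSublists {A : Set} : List (List A) → List A → Set where
  []  : DisjointSublists [] S
  _∷_ : Interleaving T R S → DisjointSublists Ts R → DisjointSublists (T ∷ Ts) S

DisjointSublists-union : DisjointSublists Ts S → Ts′ ⊆ Ts → ∃[ Y ] Y ⊆ S × Y ↭ concat Ts′
DisjointSublists-union {S = S} [] [] = [] , minimum S , ↭-refl
DisjointSublists-union (sp ∷ ds) (_ ∷ʳ σ) =
  let Y , υ , Y↭ = DisjointSublists-union ds σ in Y , ⊆-trans υ (Interleaving⇒⊆ʳ sp) , Y↭
DisjointSublists-union (sp ∷ ds) (refl ∷ σ) =
  let Y₀ , υ₀ , Y₀↭ = DisjointSublists-union ds σ
      Y , υ , sp′ = Interleaving-⊆ʳ sp υ₀
  in Y , υ , ↭-trans (toPermutation sp′) (++⁺ˡ _ Y₀↭)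

sum-map-concat : (f : A → ℕ) (Ts : List (List A)) →
  sum (map f (concat Ts)) ≡ sum (map (λ T → sum (map f T)) Ts)
sum-map-concat f [] = refl
sum-map-concat f (T ∷ Ts) = begin
  sum (map f (T ++ concat Ts))              ≡⟨ cong sum (map-++ f T (concat Ts)) ⟩
  sum (map f T ++ map f (concat Ts))        ≡⟨ sum-++ (map f T) _ ⟩
  sum (map f T) + sum (map f (concat Ts))   ≡⟨ cong (sum (map f T) +_) (sum-map-concat f Ts) ⟩
  sum (map f T) + sum (map (λ T → sum (map f T)) Ts) ∎
  where open ≡-Reasoning

length-concat-bounds : ∀ {n} → All (λ T → 1 ≤ length T × length T ≤ n) Ts →
  length Ts ≤ length (concat Ts) × length (concat Ts) ≤ length Ts * n
length-concat-bounds [] = z≤n , z≤n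
length-concat-bounds {Ts = T ∷ Ts} ((1≤|T| , |T|≤n) ∷ bs) =
  let lower , upper = length-concat-bounds bs
      |T++concat| = length-++ T {concat Ts}
  in  subst (suc (length Ts) ≤_) (sym |T++concat|) (+-mono-≤ 1≤|T| lower)
    , subst (_≤ _) (sym |T++concat|) (+-mono-≤ |T|≤n upper)

sum-map-% : (k : ℕ) .{{_ : NonZero k}} (f : A → ℕ) (L : List A) →
  sum (map f L) % k ≡ sum (map (λ x → f x % k) L) % k
sum-map-% k f [] = refl
sum-map-% k f (x ∷ L) = begin
  (f x + s) % k              ≡⟨ %-distribˡ-+ (f x) s k ⟩
  (f x % k + s % k) % k      ≡⟨ cong (λ t → (f x % k + t) % k) (sum-map-% k f L) ⟩
  (f x % k + s′ % k) % k     ≡⟨ cong (λ t → (t + s′ % k) % k) (m%n%n≡m%n (f x) k) ⟨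
  (f x % k % k + s′ % k) % k ≡⟨ %-distribˡ-+ (f x % k) s′ k ⟨
  (f x % k + s′) % k         ∎
  where
  open ≡-Reasoning
  s s′ : ℕ
  s = sum (map f L)
  s′ = sum (map (λ x → f x % k) L)

∣-sum-map-% : (k : ℕ) .{{_ : NonZero k}} (f : A → ℕ) (L : List A) →
  k ∣ sum (map (λ x → f x % k) L) → k ∣ sum (map f L)
∣-sum-map-% k f L k∣ = m%n≡0⇒n∣m _ k (trans (sum-map-% k f L) (n∣m⇒m%n≡0 _ k k∣))

sum-map-/ : (k : ℕ) .{{_ : NonZero k}} (f : A → ℕ) {L : List A} →
  All (λ x → k ∣ f x) L → sum (map f L) ≡ sum (map (λ x → f x / k) L) * k
sum-map-/ k f [] = refl
sum-map-/ k f {x ∷ L} (k∣fx ∷ k∣s) = begin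
  f x + sum (map f L)                                 ≡⟨ cong₂ _+_ (m/n*n≡m k∣fx) (sym (sum-map-/ k f k∣s)) ⟨
  f x / k * k + sum (map (λ x → f x / k) L) * k       ≡⟨ *-distribʳ-+ k (f x / k) _ ⟨
  (f x / k + sum (map (λ x → f x / k) L)) * k         ∎
  where open ≡-Reasoning

coordSum : ∀ {N r} → Fin r → Seq N r → ℕ
coordSum i T = sum (map (λ g → toℕ (lookup g i)) T)

residues : ∀ {r} (k : ℕ) .{{_ : NonZero k}} → (Fin r → ℕ) → Elt k r
residues k v = tabulate (λ i → v i mod k)

∣-coordSum-residues : ∀ {r} (k : ℕ) .{{_ : NonZero k}} (v : A → Fin r → ℕ) (i : Fin r) (L : List A) →
  k ∣ coordSum i (map (λ x → residues k (v x)) L) → k ∣ sum (map (λ x → v x i) L)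
∣-coordSum-residues k v i L k∣ = ∣-sum-map-% k (λ x → v x i) L (subst (k ∣_) coordSum≡ k∣)
  where
  coordSum≡ : coordSum i (map (λ x → residues k (v x)) L) ≡ sum (map (λ x → v x i % k) L)
  coordSum≡ = cong sum (trans (sym (map-∘ L))
    (map-cong (λ x → trans (cong toℕ (lookup∘tabulate _ i)) (toℕ-fromℕ< _)) L))

ShortZeroSumMod : ∀ {N r} → ℕ → Seq N r → Set
ShortZeroSumMod n T = (∀ i → n ∣ coordSum i T) × 1 ≤ length T × length T ≤ n

module _ {N r n : ℕ} .{{_ : NonZero n}} where

  reduceMod : Elt N r → Elt n r
  reduceMod g = residues n (λ i → toℕ (lookup g i))

  extractBlock : ∀ {dn} → EtaProp n r dn → (S : Seq N r) → dn ≤ length S →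
    ∃[ T ] ∃[ R ] Interleaving T R S × ShortZeroSumMod n T
  extractBlock E S dn≤|S| with E (map reduceMod S) (subst (_ ≤_) (sym (length-map _ S)) dn≤|S|)
  ... | _ , τ , zero-sum , 1≤|T| , |T|≤n with ⊆-map⁻ reduceMod S τ
  ... | T , σ , refl =
    let R , sp = ⊆⇒Interleaving σ
    in T , R , sp
      , (λ i → ∣-coordSum-residues n (λ g i → toℕ (lookup g i)) i T (zero-sum i))
      , subst (1 ≤_) (length-map _ T) 1≤|T| , subst (_≤ n) (length-map _ T) |T|≤n

  extractBlocks : ∀ {dn} → EtaProp n r dn → (k : ℕ) (S : Seq N r) → k * n + dn ≤ length S →
    ∃[ Ts ] DisjointSublists Ts S × All (ShortZeroSumMod n) Ts × length Ts ≡ suc k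
  extractBlocks E zero S dn≤|S| with extractBlock E S dn≤|S|
  ... | T , R , sp , block = T ∷ [] , sp ∷ [] , block ∷ [] , refl
  extractBlocks {dn} E (suc k) S bound≤|S| with extractBlock E S (≤-trans (m≤n+m dn _) bound≤|S|)
  ... | T , R , sp , block@(_ , _ , |T|≤n) with extractBlocks E k R bound≤|R|
    where
    bound≤|R| : k * n + dn ≤ length R
    bound≤|R| = +-cancelˡ-≤ n _ _ (begin
      n + (k * n + dn)      ≡⟨ +-assoc n (k * n) dn ⟨
      suc k * n + dn        ≤⟨ bound≤|S| ⟩
      length S              ≡⟨ interleave-length sp ⟩
      length T + length R   ≤⟨ +-monoˡ-≤ (length R) |T|≤n ⟩
      n + length R          ∎)
      where open ≤-Reasoning
  ... | Ts , ds , blocks , |Ts| = T ∷ Ts , sp ∷ ds , block ∷ blocks , cong suc |Ts|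

quotientSum : ∀ {N r} (n m : ℕ) .{{_ : NonZero n}} .{{_ : NonZero m}} → Seq N r → Elt m r
quotientSum n m T = residues m (λ i → coordSum i T / n)

EtaProp-* : ∀ {m n r dm dn} .{{_ : NonZero m}} .{{_ : NonZero n}} →
  EtaProp m r dm → EtaProp n r dn → EtaProp (m * n) r ((dm ∸ 1) * n + dn)
EtaProp-* {m} {n} {dm = dm} Em En S bound≤|S| with extractBlocks En (dm ∸ 1) S bound≤|S|
... | Ts , ds , blocks , |Ts|
  with Em (map (quotientSum n m) Ts) (subst (dm ≤_) (sym (trans (length-map (quotientSum n m) Ts) |Ts|)) (m≤n+m∸n dm 1))
... | _ , υ , zero-sum , 1≤|U| , |U|≤m with ⊆-map⁻ (quotientSum n m) Ts υ
... | Ts′ , σ , refl with DisjointSublists-union ds σ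
... | Y , Y⊆S , Y↭ = Y , Y⊆S , Y-zero-sum , 1≤|Y| , |Y|≤mn
  where
  blocks′ : All (ShortZeroSumMod n) Ts′
  blocks′ = All-resp-⊆ σ blocks

  Y-zero-sum : ZeroSum Y
  Y-zero-sum i = subst (m * n ∣_) (sym coordSum-Y)
    (*-pres-∣ (∣-coordSum-residues m (λ T i → coordSum i T / n) i Ts′ (zero-sum i)) (∣-refl {n}))
    where
    open ≡-Reasoning
    coordSum-Y : coordSum i Y ≡ sum (map (λ T → coordSum i T / n) Ts′) * n
    coordSum-Y = begin
      coordSum i Y                     ≡⟨ sum-↭ (map⁺ _ Y↭) ⟩
      coordSum i (concat Ts′)          ≡⟨ sum-map-concat _ Ts′ ⟩
      sum (map (coordSum i) Ts′)       ≡⟨ sum-map-/ n (coordSum i) (All.map (λ b → proj₁ b i) blocks′) ⟩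
      sum (map (λ T → coordSum i T / n) Ts′) * n ∎

  |Y|≡ : length Y ≡ length (concat Ts′)
  |Y|≡ = ↭-length Y↭

  |Ts′|≡ : length (map (quotientSum n m) Ts′) ≡ length Ts′
  |Ts′|≡ = length-map (quotientSum n m) Ts′

  concat-bounds : length Ts′ ≤ length (concat Ts′) × length (concat Ts′) ≤ length Ts′ * n
  concat-bounds = length-concat-bounds (All.map proj₂ blocks′)

  1≤|Y| : 1 ≤ length Y
  1≤|Y| = subst (1 ≤_) (sym |Y|≡) (≤-trans (subst (1 ≤_) |Ts′|≡ 1≤|U|) (proj₁ concat-bounds))

  |Y|≤mn : length Y ≤ m * n
  |Y|≤mn = subst (_≤ m * n) (sym |Y|≡)
    (≤-trans (proj₂ concat-bounds) (*-monoˡ-≤ n (subst (_≤ m) |Ts′|≡ |U|≤m)))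

-- c(m − 1)n + 1 + c(n − 1) = c(mn − 1) + 1 for m = 1 + a, n = 1 + b; here mn − 1 = b + an.
*-pred-identity : ∀ c a b → c * a * suc b + (1 + c * b) ≡ c * (b + a * suc b) + 1
*-pred-identity = solve-∀

lemma6p2 : (m n r c ηm ηn ηmn : ℕ) → 2 ≤ m → 2 ≤ n → 1 ≤ r →
    IsEta m r ηm → IsEta n r ηn → IsEta (m * n) r ηmn →
    ηm ∸ 1 ≡ c * (m ∸ 1) → ηn ∸ 1 ≡ c * (n ∸ 1) →
    c * (m * n ∸ 1) + 1 ≤ ηmn →
    ηmn ≡ c * (m * n ∸ 1) + 1
lemma6p2 m@(suc a) n@(suc b) r c ηm ηn ηmn (s≤s _) (s≤s _) _ (Em , _) (En , _) (_ , ηmn-minimal) ηm≡ ηn≡ lower =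
  ≤-antisym (≤-trans (ηmn-minimal _ (EtaProp-* Em En)) upper) lower
  where
  open ≤-Reasoning
  upper : (ηm ∸ 1) * n + ηn ≤ c * (m * n ∸ 1) + 1
  upper = begin
    (ηm ∸ 1) * n + ηn              ≤⟨ +-monoʳ-≤ _ (m≤n+m∸n ηn 1) ⟩
    (ηm ∸ 1) * n + (1 + (ηn ∸ 1))  ≡⟨ cong₂ (λ x y → x * n + (1 + y)) ηm≡ ηn≡ ⟩
    c * a * n + (1 + c * b)        ≡⟨ *-pred-identity c a b ⟩
    c * (m * n ∸ 1) + 1            ∎
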